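{- Let $m,n\geq 2$ and let $D_{m,n}$ be the double-tailed diamond poset with elements $a_1,\dots,a_{m-1},u,v,b_1,\dots,b_{n-1}$, whose cover relations are: $a_j$ covers $a_{j+1}$ for $1\le j\le m-2$; $a_{m-1}$ covers $u$ and $v$; $u$ and $v$ both cover $b_1$; $b_j$ covers $b_{j+1}$ for $1\le j\le n-2$. (So $u,v$ is the unique pair of incomparable elements.) Let $\sigma$ be the linear extension of $D_{m,n}$ with $\sigma(b_{n-j})=j$ for $1\le j\le n-1$, $\sigma(v)=n$, $\sigma(u)=n+1$, and $\sigma(a_{m-j})=n+1+j$ for $1\le j\le m-1$. For $\pi=\pi_1\pi_2\cdots\pi_{m+n}\in\mathcal{S}_{m+n}$, consider the initial labeling that assigns $\pi_j$ to the element $\sigma^{ -1}(m+n+1-j)$ (i.e. $a_j\mapsto \pi_j$ for $j\le m-1$, $u\mapsto \pi_m$, $v\mapsto\pi_{m+1}$, $b_j\mapsto \pi_{m+1+j}$), and run jeu de taquin with respect to $\sigma$ on it (as described in the context). The output is one of the two dual linear extensions $T_1,T_2$ of $D_{m,n}$, where both give $a_j$ the label $j$ ($j\le m-1$) and $b_j$ the label $m+1+j$ ($j\le n-1$), and $T_1$ labels $u$ by $m$ and $v$ by $m+1$, while $T_2$ labels $u$ by $m+1$ and $v$ by $m$. Let $s^{(1)}_{m,n}$ (resp. $s^{(2)}_{m,n}$) be the number of permutations $\pi\in\mathcal{S}_{m+n}$ that jeu de taquin maps to $T_1$ (resp. $T_2$). Then \[ s^{(1)}_{m,n}-s^{(2)}_{m,n}=(-1)^m\binom{n-1}{m}\,m!\,n!.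 \] In particular, $s^{(1)}_{m,n}=s^{(2)}_{m,n}$ if and only if $m\geq n$.
   Context: A labeling of a finite poset $P$ with $N$ elements is a bijection $P\to[N]=\{1,\dots,N\}$. A dual linear extension is a labeling $\iota$ with $\iota(x)>\iota(y)$ whenever $x<y$. A linear extension $\sigma:P\to[N]$ is a bijection with $\sigma(x)<\sigma(y)$ whenever $x<y$. Jeu de taquin with respect to a linear extension $\sigma$: starting from a labeling, perform $N$ rounds; in round $i$ let $x:=\sigma^{ -1}(i)$. Compare the current label of $x$ with the current labels of all elements covered by $x$. If the label of $x$ is smaller than all of them (or $x$ covers nothing), round $i$ ends. Otherwise, let $y$ be the element covered by $x$ having the smallest label; swap the labels of $x$ and $y$, and repeat this comparison step with $y$ in place of $x$ (i.e. follow the moved label). After all $N$ rounds the labeling is a dual linear extension. -}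

module Defs where

open import Data.Bool using (Bool; true; false; if_then_else_; _∨_)
open import Data.Nat using (ℕ; zero; suc; _+_; _∸_; _<ᵇ_; _≡ᵇ_; _≟_)
open import Data.List using (List; []; _∷_; _++_; map; concatMap; applyUpTo; foldl; length; filter)
open import Data.Maybe using (Maybe; just; nothing)
open import Data.List.Properties using (≡-dec)
open import Relation.Binary.PropositionalEquality using (_≡_)

-- Generic jeu de taquin on a finite poset whose N elements are
-- encoded as indices 0 … N-1.  A labeling is a list of length N
-- (entry at position x = current label of element x).

-- label of element x (default 0 outside range; never used in range)
labelAt : List ℕ → ℕ → ℕ
labelAt []       _       = 0
labelAt (l ∷ _)  zero    = l
labelAt (_ ∷ ls) (suc x) = labelAt ls x

setAt : List ℕ → ℕ → ℕ → List ℕ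
setAt []       _       _ = []
setAt (_ ∷ ls) zero    k = k ∷ ls
setAt (l ∷ ls) (suc x) k = l ∷ setAt ls x k

swapLabels : List ℕ → ℕ → ℕ → List ℕ
swapLabels L x y = setAt (setAt L x (labelAt L y)) y (labelAt L x)

argminLabel : List ℕ → List ℕ → Maybe ℕ
argminLabel L []       = nothing
argminLabel L (y ∷ ys) with argminLabel L ys
... | nothing = just y
... | just z  = if labelAt L z <ᵇ labelAt L y then just z else just y

-- The fuel bounds the number of swaps; it is always chosen ≥ N,
-- which exceeds the length of any chain, so it never runs out.
slide : ℕ → (ℕ → List ℕ) → List ℕ → ℕ → List ℕ
slide zero       covered L x = L
slide (suc fuel) covered L x with argminLabel L (covered x)
... | nothing = L
... | just y  = if labelAt L x <ᵇ labelAt L y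
                then L
                else slide fuel covered (swapLabels L x y) y

jdt : (N : ℕ) → (covered : ℕ → List ℕ) → (σinv : ℕ → ℕ) → List ℕ → List ℕ
jdt N covered σinv L₀ =
  foldl (λ L i → slide N covered L (σinv i)) L₀ (applyUpTo suc N)

-- The double-tailed diamond D_{m,n}, N = m + n elements, indices:
--   a_j ↦ j-1   (1 ≤ j ≤ m-1)
--   u   ↦ m-1
--   v   ↦ m
--   b_j ↦ m+j   (1 ≤ j ≤ n-1)

coveredD : ℕ → ℕ → ℕ → List ℕ
coveredD m n i =
  if (i + 2) <ᵇ m then (i + 1) ∷ []                 -- a_j covers a_{j+1}, j ≤ m-2
  else if (i + 2) ≡ᵇ m then (m ∸ 1) ∷ m ∷ []        -- a_{m-1} covers u and v
  else if (i ≡ᵇ (m ∸ 1)) ∨ (i ≡ᵇ m) then (m + 1) ∷ []  -- u, v cover b_1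
  else if (i + 1) <ᵇ (m + n) then (i + 1) ∷ []      -- b_j covers b_{j+1}, j ≤ n-2
  else []                                            -- b_{n-1} covers nothing

-- σ⁻¹(i) for the linear extension σ of the paper:
-- σ(b_{n-j}) = j, σ(v) = n, σ(u) = n+1, σ(a_{m-j}) = n+1+j;
-- in index terms σ(x) = m + n - x, so σ⁻¹(i) = m + n - i.
σinvD : ℕ → ℕ → ℕ → ℕ
σinvD m n i = (m + n) ∸ i

-- The initial labeling for π is π itself read as a list:
-- a_j ↦ π_j, u ↦ π_m, v ↦ π_{m+1}, b_j ↦ π_{m+1+j}.
jdtD : ℕ → ℕ → List ℕ → List ℕ
jdtD m n π = jdt (m + n) (coveredD m n) (σinvD m n) π

T₁ : ℕ → ℕ → List ℕ
T₁ m n = applyUpTo suc (m ∸ 1) ++ m ∷ suc m ∷ applyUpTo (λ j → m + 2 + j) (n ∸ 1)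

T₂ : ℕ → ℕ → List ℕ
T₂ m n = applyUpTo suc (m ∸ 1) ++ suc m ∷ m ∷ applyUpTo (λ j → m + 2 + j) (n ∸ 1)

insertions : ℕ → List ℕ → List (List ℕ)
insertions x []       = (x ∷ []) ∷ []
insertions x (y ∷ ys) = (x ∷ y ∷ ys) ∷ map (y ∷_) (insertions x ys)

permutations : List ℕ → List (List ℕ)
permutations []       = [] ∷ []
permutations (x ∷ xs) = concatMap (insertions x) (permutations xs)

S : ℕ → List (List ℕ)
S N = permutations (applyUpTo suc N)

s₁ : ℕ → ℕ → ℕ
s₁ m n = length (filter (λ π → ≡-dec _≟_ (jdtD m n π) (T₁ m n)) (S (m + n)))

s₂ : ℕ → ℕ → ℕ
s₂ m n = length (filter (λ π → ≡-dec _≟_ (jdtD m n π) (T₂ m n)) (S (m + n)))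

module Submission where

-- Jeu de taquin with respect to σ runs the rounds from the bottom of D_{m,n} upwards, and a round
-- just inserts the label of its element into the sorted labels below, except that the labels of u
-- and v may come in either order. Call u, a_{m-1}, …, a_1 the elements e_1, …, e_m. If the label
-- of e_j exceeds c of the n + j - 1 labels below it, its round exchanges the order of u and v
-- exactly when c ≥ j. Grouping permutations by their first entry, whose rank c among the remaining
-- entries takes every value equally often, the signed count s¹ - s² therefore factors as
-- n! ∏_{j=1}^{m} (j - n) = (-1)^m (n-1)(n-2)⋯(n-m) n!, which vanishes iff n ≤ m.

open import Defs

module JeuDeTaquin where

  open import Data.Bool using (Bool; true; false; if_then_else_; _xor_)
  open import Data.Bool.Properties using (T-≡)
  open import Data.Nat using (ℕ; zero; suc; _+_; _∸_; _<ᵇ_; _≡ᵇ_; _≤_; _<_; z≤n; s≤s; z<s)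
  open import Data.Nat.Properties
  open import Data.List using (List; []; _∷_; _++_; length; foldl; applyUpTo; [_])
  open import Data.List.Properties
    using (length-++; ++-assoc; foldl-∷ʳ; applyUpTo-∷ʳ; length-applyUpTo; ++-cancelˡ; ∷-injectiveˡ)
  open import Data.List.Relation.Binary.Equality.Propositional using (≋⇒≡)
  open import Data.List.Relation.Binary.Permutation.Propositional as ↭
    using (_↭_; prep; swap; ↭-refl; ↭-sym; ↭-trans; ↭⇒↭ₛ)
  open import Data.List.Relation.Binary.Permutation.Propositional.Properties using (All-resp-↭; ↭-length)
  open import Data.List.Relation.Unary.All as All using (All; []; _∷_)
  open import Data.List.Relation.Unary.All.Properties using (map⁺; concat⁺)
  open import Data.List.Relation.Unary.AllPairs as AllPairs using (AllPairs; []; _∷_)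
  open import Data.List.Relation.Unary.AllPairs.Properties using (applyUpTo⁺₁)
  open import Data.List.Relation.Unary.Linked using (Linked)
  open import Data.List.Relation.Unary.Linked.Properties using (AllPairs⇒Linked)
  open import Data.List.Relation.Unary.Sorted.TotalOrder.Properties using (↗↭↗⇒≋)
  open import Data.List.Relation.Unary.Unique.Propositional using (Unique)
  open import Data.Maybe using (just)
  open import Function.Bundles using (Equivalence)
  open import Relation.Binary.PropositionalEquality hiding ([_])
  open import Data.List.Relation.Binary.Permutation.Setoid.Properties (setoid ℕ) using (Unique-resp-↭)
  open import Relation.Nullary using (¬_; contradiction)
  open import Relation.Nullary.Reflects using (ofʸ; ofⁿ)
  open ≡-Reasoning

  <ᵇ-true : ∀ {a b} → a < b → (a <ᵇ b) ≡ true
  <ᵇ-true a<b = Equivalence.to T-≡ (<⇒<ᵇ a<b)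

  <ᵇ-false : ∀ {a b} → b ≤ a → (a <ᵇ b) ≡ false
  <ᵇ-false {a} {b} b≤a with a <ᵇ b in eq
  ... | false = refl
  ... | true  = contradiction (<ᵇ⇒< a b (Equivalence.from T-≡ eq)) (≤⇒≯ b≤a)

  ≡ᵇ-true : ∀ {a b} → a ≡ b → (a ≡ᵇ b) ≡ true
  ≡ᵇ-true {a} {b} a≡b = Equivalence.to T-≡ (≡⇒≡ᵇ a b a≡b)

  ≡ᵇ-false : ∀ {a b} → ¬ a ≡ b → (a ≡ᵇ b) ≡ false
  ≡ᵇ-false {a} {b} a≢b with a ≡ᵇ b in eq
  ... | false = refl
  ... | true  = contradiction (≡ᵇ⇒≡ a b (Equivalence.from T-≡ eq)) a≢b

  labelAt-++ : ∀ P R k → labelAt (P ++ R) (length P + k) ≡ labelAt R k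
  labelAt-++ []      R k = refl
  labelAt-++ (_ ∷ P) R k = labelAt-++ P R k

  labelAt-at : ∀ P y R → labelAt (P ++ y ∷ R) (length P) ≡ y
  labelAt-at []      y R = refl
  labelAt-at (_ ∷ P) y R = labelAt-at P y R

  setAt-at : ∀ P y R v → setAt (P ++ y ∷ R) (length P) v ≡ P ++ v ∷ R
  setAt-at []      y R v = refl
  setAt-at (x ∷ P) y R v = cong (x ∷_) (setAt-at P y R v)

  swapLabels-++ : ∀ P y Q c R →
    swapLabels (P ++ y ∷ Q ++ c ∷ R) (length P) (length P + suc (length Q)) ≡ P ++ c ∷ Q ++ y ∷ R
  swapLabels-++ []      y Q c R = cong₂ _∷_ (labelAt-at Q c R) (setAt-at Q c R y)
  swapLabels-++ (x ∷ P) y Q c R = cong (x ∷_) (swapLabels-++ P y Q c R)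

  slide-push : ∀ {f cov} P y Q c R {X} →
    argminLabel (P ++ y ∷ Q ++ c ∷ R) (cov (length P)) ≡ just (length P + suc (length Q)) →
    slide f cov ((P ++ c ∷ Q) ++ y ∷ R) (length (P ++ c ∷ Q)) ≡ (P ++ c ∷ Q) ++ X →
    slide (suc f) cov (P ++ y ∷ Q ++ c ∷ R) (length P) ≡ P ++ (if y <ᵇ c then y ∷ Q ++ c ∷ R else c ∷ Q ++ X)
  slide-push {f} {cov} P y Q c R {X} argmin rest rewrite argmin =
    trans (cong (λ b → if b then L else rest-slide) (cong₂ _<ᵇ_ (labelAt-at P y (Q ++ c ∷ R)) label-c))
          (branch (y <ᵇ c))
    where
    L : List ℕ
    L = P ++ y ∷ Q ++ c ∷ R
    z : ℕ
    z = length P + suc (length Q)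
    rest-slide : List ℕ
    rest-slide = slide f cov (swapLabels L (length P) z) z
    label-c : labelAt L z ≡ c
    label-c = trans (labelAt-++ P (y ∷ Q ++ c ∷ R) (suc (length Q))) (labelAt-at Q c R)
    branch : ∀ b → (if b then L else rest-slide) ≡ P ++ (if b then y ∷ Q ++ c ∷ R else c ∷ Q ++ X)
    branch true  = refl
    branch false = begin
      rest-slide ≡⟨ cong₂ (slide f cov) (trans (swapLabels-++ P y Q c R) (sym (++-assoc P (c ∷ Q) (y ∷ R))))
                               (sym (length-++ P)) ⟩
      slide f cov ((P ++ c ∷ Q) ++ y ∷ R) (length (P ++ c ∷ Q)) ≡⟨ rest ⟩
      (P ++ c ∷ Q) ++ X                                           ≡⟨ ++-assoc P (c ∷ Q) X ⟩
      P ++ c ∷ Q ++ X                                             ∎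

  slide-bottom : ∀ {f cov} L x → cov x ≡ [] → slide (suc f) cov L x ≡ L
  slide-bottom {cov = cov} L x eq rewrite eq = refl

  coveredD-chain : ∀ {m n x} → x + 2 < m → coveredD m n x ≡ (x + 1) ∷ []
  coveredD-chain x+2<m rewrite <ᵇ-true x+2<m = refl

  coveredD-top : ∀ {m n x} → x + 2 ≡ m → coveredD m n x ≡ (x + 1) ∷ (x + 2) ∷ []
  coveredD-top {x = x} refl rewrite <ᵇ-false (≤-refl {x + 2}) | ≡ᵇ-true (refl {x = x + 2}) =
    cong (λ k → k ∷ x + 2 ∷ []) (+-∸-assoc x {2} {1} (s≤s z≤n))

  coveredD-u : ∀ {m n x} → x + 1 ≡ m → coveredD m n x ≡ (x + 2) ∷ []
  coveredD-u {x = x} refl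
    rewrite <ᵇ-false (+-monoʳ-≤ x (n≤1+n 1))
          | ≡ᵇ-false {x + 2} {x + 1} (λ eq → 1+n≢n (+-cancelˡ-≡ x 2 1 eq))
          | ≡ᵇ-true (sym (m+n∸n≡m x 1)) = cong [_] (+-assoc x 1 1)

  coveredD-lower : ∀ {m n x} → 1 ≤ m → m ≤ x → x + 1 < m + n → coveredD m n x ≡ (x + 1) ∷ []
  coveredD-lower {suc m} {n} {x} _ 1+m≤x x+1<N
    rewrite <ᵇ-false {x + 2} {suc m} (≤-trans 1+m≤x (m≤m+n x 2))
          | ≡ᵇ-false {x + 2} {suc m} (λ eq → <⇒≱ (m<m+n x {2} z<s) (≤-trans (≤-reflexive eq) 1+m≤x))
          | ≡ᵇ-false {x} {m} (λ eq → <-irrefl (sym eq) 1+m≤x)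
    with x ≡ᵇ suc m in x≟1+m
  ... | true  = cong (λ k → k + 1 ∷ []) (sym (≡ᵇ⇒≡ x (suc m) (Equivalence.from T-≡ x≟1+m)))
  ... | false rewrite <ᵇ-true x+1<N = refl

  coveredD-bottom : ∀ {m n x} → m < x → m + n ≡ x + 1 → coveredD m n x ≡ []
  coveredD-bottom {m} {n} {x} m<x N≡x+1
    rewrite <ᵇ-false {x + 2} {m} (≤-trans (<⇒≤ m<x) (m≤m+n x 2))
          | ≡ᵇ-false {x + 2} {m} (λ eq → <⇒≱ m<x (≤-trans (m≤m+n x 2) (≤-reflexive eq)))
          | ≡ᵇ-false {x} {m ∸ 1} (λ eq → <⇒≱ m<x (≤-trans (≤-reflexive eq) (m∸n≤m m 1)))
          | ≡ᵇ-false {x} {m} (λ eq → <-irrefl (sym eq) m<x)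
          | <ᵇ-false {x + 1} {m + n} (≤-reflexive N≡x+1) = refl

  -- The outcome of one round on the labels of the moving element and of the elements below it:
  -- insert for v and the b's, insertU for u (whose label skips over v, the first entry, into the
  -- chain of b's), insertTop for a_{m-1} (covering u and v, the first two entries), and insertA k
  -- for the a with k further a's below it.

  insert : ℕ → List ℕ → List ℕ
  insert y []      = y ∷ []
  insert y (c ∷ s) = if y <ᵇ c then y ∷ c ∷ s else c ∷ insert y s

  isort : List ℕ → List ℕ
  isort []      = []
  isort (y ∷ R) = insert y (isort R)

  insertU : ℕ → List ℕ → List ℕ
  insertU y (q ∷ c ∷ s) = if y <ᵇ c then y ∷ q ∷ c ∷ s else c ∷ q ∷ insert y s
  insertU y s           = y ∷ s

  insertTop : ℕ → List ℕ → List ℕ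
  insertTop y (p ∷ q ∷ s) =
    if q <ᵇ p then (if y <ᵇ q then y ∷ p ∷ q ∷ s else q ∷ p ∷ insert y s)
              else (if y <ᵇ p then y ∷ p ∷ q ∷ s else p ∷ insertU y (q ∷ s))
  insertTop y s = y ∷ s

  insertA : ℕ → ℕ → List ℕ → List ℕ
  insertA zero    y s       = insertTop y s
  insertA (suc k) y []      = y ∷ []
  insertA (suc k) y (c ∷ s) = if y <ᵇ c then y ∷ c ∷ s else c ∷ insertA k y s

  -- The labels of the lowest k + 1 + n elements, k of them a's, once their rounds are done.
  settle : ℕ → List ℕ → List ℕ
  settle zero    []      = []
  settle zero    (p ∷ R) = insertU p (isort R)
  settle (suc k) []      = []
  settle (suc k) (y ∷ R) = insertA k y (settle k R)

  length-insert : ∀ y s → length (insert y s) ≡ suc (length s)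
  length-insert y []      = refl
  length-insert y (c ∷ s) with y <ᵇ c
  ... | true  = refl
  ... | false = cong suc (length-insert y s)

  length-isort : ∀ R → length (isort R) ≡ length R
  length-isort []      = refl
  length-isort (y ∷ R) = trans (length-insert y (isort R)) (cong suc (length-isort R))

  length-insertU : ∀ y s → length (insertU y s) ≡ suc (length s)
  length-insertU y []          = refl
  length-insertU y (q ∷ [])    = refl
  length-insertU y (q ∷ c ∷ s) with y <ᵇ c
  ... | true  = refl
  ... | false = cong (λ k → suc (suc k)) (length-insert y s)

  length-insertTop : ∀ y s → length (insertTop y s) ≡ suc (length s)
  length-insertTop y []          = refl
  length-insertTop y (p ∷ [])    = refl
  length-insertTop y (p ∷ q ∷ s) with q <ᵇ p | y <ᵇ q | y <ᵇ p
  ... | true  | true  | _     = refl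
  ... | true  | false | _     = cong (λ k → suc (suc k)) (length-insert y s)
  ... | false | _     | true  = refl
  ... | false | _     | false = cong suc (length-insertU y (q ∷ s))

  length-insertA : ∀ k y s → length (insertA k y s) ≡ suc (length s)
  length-insertA zero    y s       = length-insertTop y s
  length-insertA (suc k) y []      = refl
  length-insertA (suc k) y (c ∷ s) with y <ᵇ c
  ... | true  = refl
  ... | false = cong suc (length-insertA k y s)

  length-settle : ∀ k R → length (settle k R) ≡ length R
  length-settle zero    []      = refl
  length-settle zero    (p ∷ R) = trans (length-insertU p (isort R)) (cong suc (length-isort R))
  length-settle (suc k) []      = refl
  length-settle (suc k) (y ∷ R) = trans (length-insertA k y (settle k R)) (cong suc (length-settle k R))

  length-++-shift : ∀ (P Q R : List ℕ) {k} → length P + length (Q ++ R) ≡ k → length (P ++ Q) + length R ≡ k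
  length-++-shift P Q R {k} len = begin
    length (P ++ Q) + length R          ≡⟨ cong (_+ length R) (length-++ P) ⟩
    length P + length Q + length R      ≡⟨ +-assoc (length P) (length Q) (length R) ⟩
    length P + (length Q + length R)    ≡⟨ cong (length P +_) (sym (length-++ Q)) ⟩
    length P + length (Q ++ R)          ≡⟨ len ⟩
    k                                   ∎

  -- Jeu de taquin on D_{m,n}, round by round. A moving label sits at position x = length P of the
  -- labeling P ++ y ∷ T, so that T lists the labels of the elements below it in the labeling order.
  module Simulation (m n : ℕ) (2≤m : 2 ≤ m) (2≤n : 2 ≤ n) where

    N : ℕ
    N = m + n

    cov : ℕ → List ℕ
    cov = coveredD m n

    position-of-depth : ∀ j {x t} → x + suc t ≡ N → t ≡ j + n → x + suc j ≡ m
    position-of-depth j {x} len refl = +-cancelʳ-≡ n (x + suc j) m (trans (+-assoc x (suc j) n) len)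

    lower-position : ∀ {x t} → x + suc t ≡ N → t < n → m ≤ x
    lower-position {x} {t} len t<n = +-cancelʳ-≤ (suc t) m x (≤-trans (+-monoʳ-≤ m t<n) (≤-reflexive (sym len)))

    bottom-position : ∀ {x} → x + 1 ≡ N → m < x
    bottom-position {x} len = +-cancelʳ-≤ 1 (suc m) x
      (≤-trans (≤-reflexive (sym (+-suc m 1))) (≤-trans (+-monoʳ-≤ m 2≤n) (≤-reflexive (sym len))))

    depth≤N : ∀ {x t} → x + suc t ≡ N → t ≤ N
    depth≤N {x} {t} len = ≤-trans (n≤1+n t) (≤-trans (m≤n+m (suc t) x) (≤-reflexive len))

    relength : ∀ (P S R : List ℕ) → length S ≡ length R →
               length P + suc (length R) ≡ N → length P + suc (length S) ≡ N
    relength P S R S≡R len = trans (cong (λ k → length P + suc k) S≡R) len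

    n≢0 : ¬ 0 ≡ n
    n≢0 = <⇒≢ (≤-trans (s≤s z≤n) 2≤n)

    n≢1 : ¬ 1 ≡ n
    n≢1 = <⇒≢ 2≤n

    argmin-cover : ∀ {L x z} → cov x ≡ z ∷ [] → argminLabel L (cov x) ≡ just z
    argmin-cover {L} eq = cong (argminLabel L) eq

    argmin-top : ∀ {b} P y p q s → length P + suc (length (p ∷ q ∷ s)) ≡ N → length (p ∷ q ∷ s) ≡ suc n →
      (q <ᵇ p) ≡ b →
      argminLabel (P ++ y ∷ p ∷ q ∷ s) (cov (length P)) ≡ (if b then just (length P + 2) else just (length P + 1))
    argmin-top P y p q s len T≡ q<p =
      trans (cong (argminLabel (P ++ L)) (coveredD-top (position-of-depth 1 len T≡)))
            (cong (λ b → if b then just (length P + 2) else just (length P + 1))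
                  (trans (cong₂ _<ᵇ_ (labelAt-++ P L 2) (labelAt-++ P L 1)) q<p))
      where
      L : List ℕ
      L = y ∷ p ∷ q ∷ s

    slide-insert : ∀ f P y T → length P + suc (length T) ≡ N → length T < n → length T ≤ f →
                   slide f cov (P ++ y ∷ T) (length P) ≡ P ++ insert y T
    slide-insert zero    P y []      _   _   _ = refl
    slide-insert (suc f) P y []      len _   _ =
      slide-bottom {cov = cov} (P ++ y ∷ []) (length P) (coveredD-bottom (bottom-position len) (sym len))
    slide-insert (suc f) P y (c ∷ T) len T<n (s≤s T≤f) =
      slide-push {f} {cov} P y [] c T
        (argmin-cover (coveredD-lower (≤-trans (s≤s z≤n) 2≤m) (lower-position len T<n)
                                      (<-≤-trans (+-monoʳ-< (length P) (s≤s (s≤s z≤n))) (≤-reflexive len))))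
        (slide-insert f (P ++ [ c ]) y T (length-++-shift P [ c ] (y ∷ T) len) (<-trans (n<1+n _) T<n) T≤f)

    slide-insertU : ∀ f P y T → length P + suc (length T) ≡ N → length T ≡ n → length T ≤ f →
                    slide f cov (P ++ y ∷ T) (length P) ≡ P ++ insertU y T
    slide-insertU f       P y []          _   T≡n _ = contradiction T≡n n≢0
    slide-insertU f       P y (q ∷ [])    _   T≡n _ = contradiction T≡n n≢1
    slide-insertU (suc f) P y (q ∷ c ∷ s) len T≡n (s≤s T≤f) =
      slide-push {f} {cov} P y (q ∷ []) c s (argmin-cover (coveredD-u (position-of-depth 0 len T≡n)))
        (slide-insert f (P ++ c ∷ q ∷ []) y s (length-++-shift P (c ∷ q ∷ []) (y ∷ s) len)
                      (≤-trans (n≤1+n _) (≤-reflexive T≡n)) (≤-trans (n≤1+n _) T≤f))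

    slide-insertTop : ∀ f P y T → length P + suc (length T) ≡ N → length T ≡ suc n → length T ≤ f →
                      slide f cov (P ++ y ∷ T) (length P) ≡ P ++ insertTop y T
    slide-insertTop f       P y (p ∷ [])    _   T≡ _ = contradiction (suc-injective T≡) n≢0
    slide-insertTop (suc f) P y (p ∷ q ∷ s) len T≡ (s≤s T≤f) with q <ᵇ p in q<p
    ... | true  =
      slide-push {f} {cov} P y (p ∷ []) q s (argmin-top P y p q s len T≡ q<p)
        (slide-insert f (P ++ q ∷ p ∷ []) y s (length-++-shift P (q ∷ p ∷ []) (y ∷ s) len)
                      (≤-reflexive (suc-injective T≡)) (≤-trans (n≤1+n _) T≤f))
    ... | false =
      slide-push {f} {cov} P y [] p (q ∷ s) (argmin-top P y p q s len T≡ q<p)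
        (slide-insertU f (P ++ p ∷ []) y (q ∷ s) (length-++-shift P (p ∷ []) (y ∷ q ∷ s) len)
                       (suc-injective T≡) T≤f)

    slide-insertA : ∀ k f P y T → length P + suc (length T) ≡ N → length T ≡ suc (k + n) → length T ≤ f →
                    slide f cov (P ++ y ∷ T) (length P) ≡ P ++ insertA k y T
    slide-insertA zero    = slide-insertTop
    slide-insertA (suc k) (suc f) P y (c ∷ T) len T≡ (s≤s T≤f) =
      slide-push {f} {cov} P y [] c T
        (argmin-cover (coveredD-chain (<-≤-trans (+-monoʳ-< (length P) (s≤s (s≤s (s≤s z≤n))))
                                                 (≤-reflexive (position-of-depth (suc (suc k)) len T≡)))))
        (slide-insertA k f (P ++ [ c ]) y T (length-++-shift P [ c ] (y ∷ T) len) (suc-injective T≡) T≤f)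

    round : List ℕ → ℕ → List ℕ
    round L i = slide N cov L (σinvD m n i)

    run : ℕ → List ℕ → List ℕ
    run t L = foldl round L (applyUpTo suc t)

    run-suc : ∀ t L → run (suc t) L ≡ slide N cov (run t L) (N ∸ suc t)
    run-suc t L =
      trans (cong (foldl round L) (sym (applyUpTo-∷ʳ suc t))) (foldl-∷ʳ round L (suc t) (applyUpTo suc t))

    -- The round of σ⁻¹(length R + 1), which is the element at position length P.
    run-round : ∀ P y R {R′} → length P + length (y ∷ R) ≡ N →
      run (length R) ((P ++ [ y ]) ++ R) ≡ (P ++ [ y ]) ++ R′ →
      run (length (y ∷ R)) (P ++ y ∷ R) ≡ slide N cov (P ++ y ∷ R′) (length P)
    run-round P y R len rounds = trans (run-suc (length R) (P ++ y ∷ R))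
      (cong₂ (slide N cov)
        (trans (cong (run (length R)) (sym (++-assoc P [ y ] R))) (trans rounds (++-assoc P [ y ] _)))
        (trans (cong (_∸ suc (length R)) (sym len)) (m+n∸n≡m (length P) (suc (length R)))))

    rounds-isort : ∀ R P → length P + length R ≡ N → length R ≤ n → run (length R) (P ++ R) ≡ P ++ isort R
    rounds-isort []      P _   _   = refl
    rounds-isort (y ∷ R) P len R<n =
      trans (run-round P y R len (rounds-isort R (P ++ [ y ]) (length-++-shift P [ y ] R len) (<⇒≤ R<n)))
            (slide-insert N P y (isort R) len′ (≤-trans (s≤s (≤-reflexive (length-isort R))) R<n) (depth≤N len′))
      where
      len′ : length P + suc (length (isort R)) ≡ N
      len′ = relength P (isort R) R (length-isort R) len

    rounds-settle : ∀ k R P → length P + length R ≡ N → length R ≡ suc (k + n) →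
                    run (length R) (P ++ R) ≡ P ++ settle k R
    rounds-settle zero    (p ∷ R) P len R≡ =
      trans (run-round P p R len
              (rounds-isort R (P ++ [ p ]) (length-++-shift P [ p ] R len) (≤-reflexive (suc-injective R≡))))
            (slide-insertU N P p (isort R) len′ (trans (length-isort R) (suc-injective R≡)) (depth≤N len′))
      where
      len′ : length P + suc (length (isort R)) ≡ N
      len′ = relength P (isort R) R (length-isort R) len
    rounds-settle (suc k) (y ∷ R) P len R≡ =
      trans (run-round P y R len (rounds-settle k R (P ++ [ y ]) (length-++-shift P [ y ] R len) (suc-injective R≡)))
            (slide-insertA k N P y (settle k R) len′ (trans (length-settle k R) (suc-injective R≡)) (depth≤N len′))
      where
      len′ : length P + suc (length (settle k R)) ≡ N
      len′ = relength P (settle k R) R (length-settle k R) len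

  jdtD-settle : ∀ m n → 2 ≤ m → 2 ≤ n → ∀ π → length π ≡ m + n → jdtD m n π ≡ settle (m ∸ 1) π
  jdtD-settle (suc m) n 2≤m 2≤n π len =
    trans (cong (λ t → run t π) (sym len)) (rounds-settle m π [] len len)
    where open Simulation (suc m) n 2≤m 2≤n

  Increasing : List ℕ → Set
  Increasing = AllPairs _<_

  countBelow : ℕ → List ℕ → ℕ
  countBelow y []      = 0
  countBelow y (c ∷ s) = if c <ᵇ y then suc (countBelow y s) else countBelow y s

  -- For the labels π of the lowest k + n elements (u and k - 1 a's among them when k ≥ 1), whether
  -- after their rounds u carries a smaller label than v.
  ordered : ℕ → List ℕ → Bool
  ordered zero    _       = true
  ordered (suc k) []      = true
  ordered (suc k) (y ∷ R) = (k <ᵇ countBelow y R) xor ordered k R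

  swapUnless : Bool → ℕ → List ℕ → List ℕ
  swapUnless b zero    (x ∷ y ∷ s) = if b then x ∷ y ∷ s else y ∷ x ∷ s
  swapUnless b zero    s           = s
  swapUnless b (suc k) []          = []
  swapUnless b (suc k) (x ∷ s)     = x ∷ swapUnless b k s

  insert-↭ : ∀ y s → insert y s ↭ y ∷ s
  insert-↭ y []      = ↭-refl
  insert-↭ y (c ∷ s) with y <ᵇ c
  ... | true  = ↭-refl
  ... | false = ↭-trans (prep c (insert-↭ y s)) (swap c y ↭-refl)

  isort-↭ : ∀ R → isort R ↭ R
  isort-↭ []      = ↭-refl
  isort-↭ (y ∷ R) = ↭-trans (insert-↭ y (isort R)) (prep y (isort-↭ R))

  insertions-↭ : ∀ x σ → All (_↭ x ∷ σ) (insertions x σ)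
  insertions-↭ x []      = ↭-refl ∷ []
  insertions-↭ x (y ∷ σ) =
    ↭-refl ∷ map⁺ (All.map (λ p → ↭-trans (prep y p) (swap y x ↭-refl)) (insertions-↭ x σ))

  permutations-↭ : ∀ xs → All (_↭ xs) (permutations xs)
  permutations-↭ []       = ↭-refl ∷ []
  permutations-↭ (x ∷ xs) =
    concat⁺ (map⁺ (All.map (λ σ↭xs → All.map (λ p → ↭-trans p (prep x σ↭xs)) (insertions-↭ x _))
                           (permutations-↭ xs)))

  countBelow-↭ : ∀ y {xs ys} → xs ↭ ys → countBelow y xs ≡ countBelow y ys
  countBelow-↭ y ↭.refl        = refl
  countBelow-↭ y (prep x p)   rewrite countBelow-↭ y p = refl
  countBelow-↭ y (swap a b p) rewrite countBelow-↭ y p with a <ᵇ y | b <ᵇ y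
  ... | true  | true  = refl
  ... | true  | false = refl
  ... | false | true  = refl
  ... | false | false = refl
  countBelow-↭ y (↭.trans p q) = trans (countBelow-↭ y p) (countBelow-↭ y q)

  unique-↭ : ∀ {xs ys} → xs ↭ ys → Unique xs → Unique ys
  unique-↭ p = Unique-resp-↭ (↭⇒↭ₛ p)

  increasing-↭⇒≡ : ∀ {xs ys} → Increasing xs → Increasing ys → xs ↭ ys → xs ≡ ys
  increasing-↭⇒≡ xs↗ ys↗ p = ≋⇒≡ (↗↭↗⇒≋ ≤-totalOrder (sorted xs↗) (sorted ys↗) (↭⇒↭ₛ p))
    where
    sorted : ∀ {zs} → Increasing zs → Linked _≤_ zs
    sorted zs↗ = AllPairs⇒Linked (AllPairs.map <⇒≤ zs↗)

  ≮∧≢⇒> : ∀ {y c} → ¬ y < c → y ≢ c → c < y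
  ≮∧≢⇒> y≮c y≢c = ≤∧≢⇒< (≮⇒≥ y≮c) (≢-sym y≢c)

  below-head : ∀ {y c s} → y < c → Increasing (c ∷ s) → All (y <_) (c ∷ s)
  below-head y<c (c< ∷ _) = y<c ∷ All.map (<-trans y<c) c<

  countBelow-least : ∀ {y s} → All (y <_) s → countBelow y s ≡ 0
  countBelow-least []          = refl
  countBelow-least (y<c ∷ y<s) rewrite <ᵇ-false (<⇒≤ y<c) = countBelow-least y<s

  insert-increasing : ∀ y s → Increasing s → All (y ≢_) s → Increasing (insert y s)
  insert-increasing y []      _          _           = [] ∷ []
  insert-increasing y (c ∷ s) s↗@(c< ∷ c↗) (y≢c ∷ y∉s) with y <ᵇ c | <ᵇ-reflects-< y c
  ... | true  | ofʸ y<c = below-head y<c s↗ ∷ s↗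
  ... | false | ofⁿ y≮c =
    All-resp-↭ (↭-sym (insert-↭ y s)) (≮∧≢⇒> y≮c y≢c ∷ c<) ∷ insert-increasing y s c↗ y∉s

  isort-increasing : ∀ R → Unique R → Increasing (isort R)
  isort-increasing []      []          = []
  isort-increasing (y ∷ R) (y∉R ∷ R!) =
    insert-increasing y (isort R) (isort-increasing R R!) (All-resp-↭ (↭-sym (isort-↭ R)) y∉R)

  insertU-swapUnless : ∀ p s → Increasing s → All (p ≢_) s → 2 ≤ length s →
    insertU p s ≡ swapUnless ((0 <ᵇ countBelow p s) xor true) 0 (insert p s)
  insertU-swapUnless p (_ ∷ []) _ _ (s≤s ())
  insertU-swapUnless p (s₀ ∷ s₁ ∷ s) s↗@((s₀<s₁ ∷ _) ∷ _) (p≢s₀ ∷ _) _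
    with p <ᵇ s₀ | <ᵇ-reflects-< p s₀
  ... | true  | ofʸ p<s₀ rewrite countBelow-least (below-head p<s₀ s↗) | <ᵇ-true (<-trans p<s₀ s₀<s₁) = refl
  ... | false | ofⁿ p≮s₀ rewrite <ᵇ-true (≮∧≢⇒> p≮s₀ p≢s₀) with p <ᵇ s₁
  ...   | true  = refl
  ...   | false = refl

  insertTop-swapUnless : ∀ y b s → Increasing s → All (y ≢_) s → 3 ≤ length s →
    insertTop y (swapUnless b 0 s) ≡ swapUnless ((1 <ᵇ countBelow y s) xor b) 1 (insert y s)
  insertTop-swapUnless y b (_ ∷ _ ∷ []) _ _ (s≤s (s≤s ()))
  insertTop-swapUnless y true (s₀ ∷ s₁ ∷ s₂ ∷ s)
                       s↗@((s₀<s₁ ∷ _) ∷ s₁↗@((s₁<s₂ ∷ _) ∷ _)) (y≢s₀ ∷ y≢s₁ ∷ _) _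
    rewrite <ᵇ-false (<⇒≤ s₀<s₁) with y <ᵇ s₀ | <ᵇ-reflects-< y s₀
  ... | true  | ofʸ y<s₀ rewrite countBelow-least (below-head y<s₀ s↗) = refl
  ... | false | ofⁿ y≮s₀ rewrite <ᵇ-true (≮∧≢⇒> y≮s₀ y≢s₀) with y <ᵇ s₁ | <ᵇ-reflects-< y s₁
  ...   | true  | ofʸ y<s₁ rewrite countBelow-least (below-head y<s₁ s₁↗) | <ᵇ-true (<-trans y<s₁ s₁<s₂) = refl
  ...   | false | ofⁿ y≮s₁ rewrite <ᵇ-true (≮∧≢⇒> y≮s₁ y≢s₁) with y <ᵇ s₂
  ...     | true  = refl
  ...     | false = refl
  insertTop-swapUnless y false (s₀ ∷ s₁ ∷ s₂ ∷ s)
                       s↗@((s₀<s₁ ∷ _) ∷ s₁↗@((s₁<s₂ ∷ _) ∷ _)) (y≢s₀ ∷ y≢s₁ ∷ _) _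
    rewrite <ᵇ-true s₀<s₁ with y <ᵇ s₀ | <ᵇ-reflects-< y s₀
  ... | true  | ofʸ y<s₀ rewrite countBelow-least (below-head y<s₀ s↗) = refl
  ... | false | ofⁿ y≮s₀ rewrite <ᵇ-true (≮∧≢⇒> y≮s₀ y≢s₀) with y <ᵇ s₁ | <ᵇ-reflects-< y s₁
  ...   | true  | ofʸ y<s₁ rewrite countBelow-least (below-head y<s₁ s₁↗) | <ᵇ-true (<-trans y<s₁ s₁<s₂) = refl
  ...   | false | ofⁿ y≮s₁ rewrite <ᵇ-true (≮∧≢⇒> y≮s₁ y≢s₁) with y <ᵇ s₂
  ...     | true  = refl
  ...     | false = refl

  insertA-swapUnless : ∀ k y b s → Increasing s → All (y ≢_) s → k + 3 ≤ length s →
    insertA k y (swapUnless b k s) ≡ swapUnless ((suc k <ᵇ countBelow y s) xor b) (suc k) (insert y s)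
  insertA-swapUnless zero    y b s       s↗ y∉s len = insertTop-swapUnless y b s s↗ y∉s len
  insertA-swapUnless (suc k) y b (c ∷ s) s↗@(_ ∷ c↗) (y≢c ∷ y∉s) (s≤s len) with y <ᵇ c | <ᵇ-reflects-< y c
  ... | true  | ofʸ y<c rewrite countBelow-least (below-head y<c s↗) = refl
  ... | false | ofⁿ y≮c rewrite <ᵇ-true (≮∧≢⇒> y≮c y≢c) =
    cong (c ∷_) (insertA-swapUnless k y b s c↗ y∉s len)

  settle-swapUnless : ∀ k π → Unique π → k + 3 ≤ length π →
                      settle k π ≡ swapUnless (ordered (suc k) π) k (isort π)
  settle-swapUnless zero (p ∷ R) (p∉R ∷ R!) (s≤s len) = begin
    insertU p (isort R)
      ≡⟨ insertU-swapUnless p (isort R) (isort-increasing R R!) (All-resp-↭ (↭-sym (isort-↭ R)) p∉R)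
                            (≤-trans len (≤-reflexive (sym (length-isort R)))) ⟩
    swapUnless ((0 <ᵇ countBelow p (isort R)) xor true) 0 (insert p (isort R))
      ≡⟨ cong (λ c → swapUnless ((0 <ᵇ c) xor true) 0 (insert p (isort R))) (countBelow-↭ p (isort-↭ R)) ⟩
    swapUnless ((0 <ᵇ countBelow p R) xor true) 0 (insert p (isort R)) ∎
  settle-swapUnless (suc k) (y ∷ R) (y∉R ∷ R!) (s≤s len) = begin
    insertA k y (settle k R)
      ≡⟨ cong (insertA k y) (settle-swapUnless k R R! len) ⟩
    insertA k y (swapUnless (ordered (suc k) R) k (isort R))
      ≡⟨ insertA-swapUnless k y (ordered (suc k) R) (isort R) (isort-increasing R R!)
                            (All-resp-↭ (↭-sym (isort-↭ R)) y∉R)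
                          (≤-trans len (≤-reflexive (sym (length-isort R)))) ⟩
    swapUnless ((suc k <ᵇ countBelow y (isort R)) xor ordered (suc k) R) (suc k) (insert y (isort R))
      ≡⟨ cong (λ c → swapUnless ((suc k <ᵇ c) xor ordered (suc k) R) (suc k) (insert y (isort R)))
              (countBelow-↭ y (isort-↭ R)) ⟩
    swapUnless ((suc k <ᵇ countBelow y R) xor ordered (suc k) R) (suc k) (insert y (isort R)) ∎

  applyUpTo-++ : ∀ (f : ℕ → ℕ) a b → applyUpTo f (a + b) ≡ applyUpTo f a ++ applyUpTo (λ i → f (a + i)) b
  applyUpTo-++ f zero    b = refl
  applyUpTo-++ f (suc a) b = cong (f 0 ∷_) (applyUpTo-++ (λ i → f (suc i)) a b)

  applyUpTo-cong : ∀ {f g : ℕ → ℕ} n → (∀ i → f i ≡ g i) → applyUpTo f n ≡ applyUpTo g n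
  applyUpTo-cong zero    f≗g = refl
  applyUpTo-cong (suc n) f≗g = cong₂ _∷_ (f≗g 0) (applyUpTo-cong n (λ i → f≗g (suc i)))

  upTo-T₁ : ∀ m n → 1 ≤ m → 1 ≤ n → applyUpTo suc (m + n) ≡ T₁ m n
  upTo-T₁ (suc m) (suc n) _ _ = begin
    applyUpTo suc (suc m + suc n)     ≡⟨ cong (applyUpTo suc) (sym (+-suc m (suc n))) ⟩
    applyUpTo suc (m + suc (suc n))   ≡⟨ applyUpTo-++ suc m (suc (suc n)) ⟩
    applyUpTo suc m ++ suc (m + 0) ∷ suc (m + 1) ∷ applyUpTo (λ i → suc (m + suc (suc i))) n
      ≡⟨ cong (applyUpTo suc m ++_) (cong₂ _∷_ (cong suc (+-identityʳ m)) (cong₂ _∷_ (cong suc (+-comm m 1))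
           (applyUpTo-cong n (λ i → cong suc (sym (+-assoc m 2 i)))))) ⟩
    T₁ (suc m) (suc n)                ∎

  swapUnless-++ : ∀ b P s → swapUnless b (length P) (P ++ s) ≡ P ++ swapUnless b 0 s
  swapUnless-++ b []      s = refl
  swapUnless-++ b (x ∷ P) s = cong (x ∷_) (swapUnless-++ b P s)

  swapUnless-T₁ : ∀ b m n → swapUnless b (m ∸ 1) (T₁ m n) ≡ (if b then T₁ m n else T₂ m n)
  swapUnless-T₁ b m n =
    trans (cong (λ k → swapUnless b k (T₁ m n)) (sym (length-applyUpTo suc (m ∸ 1))))
          (trans (swapUnless-++ b (applyUpTo suc (m ∸ 1)) _) (middle b))
    where
    middle : ∀ b → applyUpTo suc (m ∸ 1) ++ swapUnless b 0 (m ∷ suc m ∷ applyUpTo (λ j → m + 2 + j) (n ∸ 1))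
                   ≡ (if b then T₁ m n else T₂ m n)
    middle true  = refl
    middle false = refl

  upTo-increasing : ∀ N → Increasing (applyUpTo suc N)
  upTo-increasing N = applyUpTo⁺₁ suc N (λ i<j _ → s≤s i<j)

  jdtD-permutation : ∀ m n → 2 ≤ m → 2 ≤ n → ∀ π → π ↭ applyUpTo suc (m + n) →
                     jdtD m n π ≡ (if ordered m π then T₁ m n else T₂ m n)
  jdtD-permutation m@(suc k) n 2≤m 2≤n π π↭ = begin
    jdtD m n π                                        ≡⟨ jdtD-settle m n 2≤m 2≤n π |π| ⟩
    settle k π                                        ≡⟨ settle-swapUnless k π π! k+3≤|π| ⟩
    swapUnless (ordered m π) k (isort π)              ≡⟨ cong (swapUnless (ordered m π) k) sorted ⟩
    swapUnless (ordered m π) k (applyUpTo suc (m + n))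
      ≡⟨ cong (swapUnless (ordered m π) k) (upTo-T₁ m n (s≤s z≤n) (≤-trans (s≤s z≤n) 2≤n)) ⟩
    swapUnless (ordered m π) k (T₁ m n)               ≡⟨ swapUnless-T₁ (ordered m π) m n ⟩
    (if ordered m π then T₁ m n else T₂ m n)          ∎
    where
    π! : Unique π
    π! = unique-↭ (↭-sym π↭) (AllPairs.map <⇒≢ (upTo-increasing (m + n)))
    |π| : length π ≡ m + n
    |π| = trans (↭-length π↭) (length-applyUpTo suc (m + n))
    k+3≤|π| : k + 3 ≤ length π
    k+3≤|π| = ≤-trans (≤-reflexive (+-suc k 2)) (≤-trans (s≤s (+-monoʳ-≤ k 2≤n)) (≤-reflexive (sym |π|)))
    sorted : isort π ≡ applyUpTo suc (m + n)
    sorted = increasing-↭⇒≡ (isort-increasing π π!) (upTo-increasing (m + n)) (↭-trans (isort-↭ π) π↭)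

  T₁≢T₂ : ∀ m n → T₁ m n ≢ T₂ m n
  T₁≢T₂ m n eq = 1+n≢n (sym (∷-injectiveˡ (++-cancelˡ (applyUpTo suc (m ∸ 1)) _ _ eq)))

module SignedCount where

  open JeuDeTaquin
  open import Data.Bool using (Bool; true; false; if_then_else_; not; _xor_)
  open import Data.Bool.Properties using (T-≡)
  open import Data.Nat as ℕ using (ℕ; zero; suc; _≤_; _<_; s≤s; s≤s⁻¹; _<ᵇ_; _!; _∸_; _≟_)
  import Data.Nat.Properties as ℕ
  open import Data.Nat.Combinatorics using (_C_; nCk≡nPk/k!; k>n⇒nCk≡0)
  open import Data.Nat.Combinatorics.Base using (_P_; _P′_)
  open import Data.Nat.Combinatorics.Specification using (k!∣nP′k)
  open import Data.Nat.DivMod using (m/n*n≡m)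
  open import Data.Integer using (ℤ; +_; _+_; _*_; _-_; -_; _^_; 0ℤ; 1ℤ; -1ℤ)
  import Data.Integer.Properties as ℤ
  open import Data.Integer.Tactic.RingSolver using (solve-∀)
  open import Data.Product using (_×_; _,_; proj₁; proj₂; map₂)
  open import Data.Sum using (inj₁; inj₂)
  open import Data.List using (List; []; _∷_; _++_; length; concatMap; map; applyUpTo; upTo; filter)
  open import Data.List.Properties using (≡-dec; length-map; length-applyUpTo; map-upTo; filter-accept; filter-reject)
  open import Data.List.Relation.Unary.All as All using (All; []; _∷_)
  open import Data.List.Relation.Unary.All.Properties using (map⁺; applyUpTo⁺₁; applyUpTo⁺₂)
  open import Data.List.Relation.Unary.AllPairs using ([]; _∷_)
  open import Function using (id; _∘_)
  open import Function.Bundles using (_⇔_; mk⇔; Equivalence)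
  open import Relation.Binary.PropositionalEquality
  open import Relation.Nullary using (yes; no; contradiction)
  open ≡-Reasoning

  ∑ : ∀ {A : Set} → (A → ℤ) → List A → ℤ
  ∑ f []       = 0ℤ
  ∑ f (x ∷ xs) = f x + ∑ f xs

  ∑-++ : ∀ {A : Set} (f : A → ℤ) xs ys → ∑ f (xs ++ ys) ≡ ∑ f xs + ∑ f ys
  ∑-++ f []       ys = sym (ℤ.+-identityˡ (∑ f ys))
  ∑-++ f (x ∷ xs) ys = trans (cong (_+_ (f x)) (∑-++ f xs ys)) (sym (ℤ.+-assoc (f x) (∑ f xs) (∑ f ys)))

  ∑-map : ∀ {A B : Set} (f : B → ℤ) (g : A → B) xs → ∑ f (map g xs) ≡ ∑ (λ x → f (g x)) xs
  ∑-map f g []       = refl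
  ∑-map f g (x ∷ xs) = cong (_+_ (f (g x))) (∑-map f g xs)

  ∑-concatMap : ∀ {A B : Set} (f : B → ℤ) (g : A → List B) xs →
                ∑ f (concatMap g xs) ≡ ∑ (λ x → ∑ f (g x)) xs
  ∑-concatMap f g []       = refl
  ∑-concatMap f g (x ∷ xs) = trans (∑-++ f (g x) (concatMap g xs)) (cong (_+_ (∑ f (g x))) (∑-concatMap f g xs))

  ∑-cong : ∀ {A : Set} {f g : A → ℤ} {xs} → All (λ x → f x ≡ g x) xs → ∑ f xs ≡ ∑ g xs
  ∑-cong []         = refl
  ∑-cong (eq ∷ eqs) = cong₂ _+_ eq (∑-cong eqs)

  ∑-+ : ∀ {A : Set} (f g : A → ℤ) xs → ∑ (λ x → f x + g x) xs ≡ ∑ f xs + ∑ g xs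
  ∑-+ f g []       = refl
  ∑-+ f g (x ∷ xs) = trans (cong (_+_ (f x + g x)) (∑-+ f g xs)) (interchange (f x) (g x) (∑ f xs) (∑ g xs))
    where
    interchange : ∀ a b c d → a + b + (c + d) ≡ a + c + (b + d)
    interchange = solve-∀

  ∑-*ˡ : ∀ {A : Set} c (f : A → ℤ) xs → ∑ (λ x → c * f x) xs ≡ c * ∑ f xs
  ∑-*ˡ c f []       = sym (ℤ.*-zeroʳ c)
  ∑-*ˡ c f (x ∷ xs) = trans (cong (_+_ (c * f x)) (∑-*ˡ c f xs)) (sym (ℤ.*-distribˡ-+ c (f x) (∑ f xs)))

  ∑-*ʳ : ∀ {A : Set} (f : A → ℤ) c xs → ∑ (λ x → f x * c) xs ≡ ∑ f xs * c
  ∑-*ʳ f c []       = sym (ℤ.*-zeroˡ c)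
  ∑-*ʳ f c (x ∷ xs) = trans (cong (_+_ (f x * c)) (∑-*ʳ f c xs)) (sym (ℤ.*-distribʳ-+ c (f x) (∑ f xs)))

  ∑-const : ∀ {A : Set} {f : A → ℤ} c {xs} → All (λ x → f x ≡ c) xs → ∑ f xs ≡ + length xs * c
  ∑-const c {[]}     []         = sym (ℤ.*-zeroˡ c)
  ∑-const c {x ∷ xs} (eq ∷ eqs) = trans (cong₂ _+_ eq (∑-const c eqs)) (sym (ℤ.suc-* (+ length xs) c))

  selections : List ℕ → List (ℕ × List ℕ)
  selections []       = []
  selections (x ∷ xs) = (x , xs) ∷ map (map₂ (x ∷_)) (selections xs)

  byFirst : (List ℕ → ℤ) → ℕ × List ℕ → ℤ
  byFirst h (y , r) = ∑ (λ ρ → h (y ∷ ρ)) (permutations r)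

  -- By induction on xs: a permutation of x ∷ y ∷ ys either starts with x, or starts with the first
  -- entry z of a permutation of y ∷ ys, followed by x inserted into the rest.
  ∑-permutations : ∀ x xs (h : List ℕ → ℤ) →
                   ∑ h (permutations (x ∷ xs)) ≡ ∑ (byFirst h) (selections (x ∷ xs))
  ∑-permutations x []       h = sym (ℤ.+-identityʳ _)
  ∑-permutations x (y ∷ ys) h = begin
    ∑ h (permutations (x ∷ y ∷ ys))
      ≡⟨ ∑-concatMap h (insertions x) (permutations (y ∷ ys)) ⟩
    ∑ h⁺ (permutations (y ∷ ys))
      ≡⟨ ∑-permutations y ys h⁺ ⟩
    ∑ (byFirst h⁺) (selections (y ∷ ys))
      ≡⟨ ∑-cong (All.universal split (selections (y ∷ ys))) ⟩
    ∑ (λ p → byFirst hₓ p + byFirst h (map₂ (x ∷_) p)) (selections (y ∷ ys))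
      ≡⟨ ∑-+ (byFirst hₓ) (λ p → byFirst h (map₂ (x ∷_) p)) (selections (y ∷ ys)) ⟩
    ∑ (byFirst hₓ) (selections (y ∷ ys)) + ∑ (λ p → byFirst h (map₂ (x ∷_) p)) (selections (y ∷ ys))
      ≡⟨ cong₂ _+_ (sym (∑-permutations y ys hₓ))
                   (sym (∑-map (byFirst h) (map₂ (x ∷_)) (selections (y ∷ ys)))) ⟩
    ∑ hₓ (permutations (y ∷ ys)) + ∑ (byFirst h) (map (map₂ (x ∷_)) (selections (y ∷ ys))) ∎
    where
    h⁺ hₓ : List ℕ → ℤ
    h⁺ σ = ∑ h (insertions x σ)
    hₓ ρ = h (x ∷ ρ)
    split : ∀ p → byFirst h⁺ p ≡ byFirst hₓ p + byFirst h (map₂ (x ∷_) p)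
    split (z , r) = begin
      ∑ (λ ρ → h (x ∷ z ∷ ρ) + ∑ h (map (z ∷_) (insertions x ρ))) (permutations r)
        ≡⟨ ∑-cong (All.universal (λ ρ → cong (_+_ (h (x ∷ z ∷ ρ))) (∑-map h (z ∷_) (insertions x ρ)))
                                 (permutations r)) ⟩
      ∑ (λ ρ → h (x ∷ z ∷ ρ) + ∑ (λ σ → h (z ∷ σ)) (insertions x ρ)) (permutations r)
        ≡⟨ ∑-+ (λ ρ → h (x ∷ z ∷ ρ)) (λ ρ → ∑ (λ σ → h (z ∷ σ)) (insertions x ρ))
               (permutations r) ⟩
      byFirst hₓ (z , r) + ∑ (λ ρ → ∑ (λ σ → h (z ∷ σ)) (insertions x ρ)) (permutations r)
        ≡⟨ cong (_+_ (byFirst hₓ (z , r)))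
                (sym (∑-concatMap (λ σ → h (z ∷ σ)) (insertions x) (permutations r))) ⟩
      byFirst hₓ (z , r) + byFirst h (z , x ∷ r) ∎

  length-selections : ∀ xs → length (selections xs) ≡ length xs
  length-selections []       = refl
  length-selections (x ∷ xs) = cong suc (trans (length-map (map₂ (x ∷_)) (selections xs)) (length-selections xs))

  selections-remainder-length : ∀ xs → All (λ p → suc (length (proj₂ p)) ≡ length xs) (selections xs)
  selections-remainder-length []       = []
  selections-remainder-length (x ∷ xs) = refl ∷ map⁺ (All.map (cong suc) (selections-remainder-length xs))

  selections-All : ∀ {Q : ℕ → Set} {xs} → All Q xs → All (λ p → Q (proj₁ p) × All Q (proj₂ p)) (selections xs)
  selections-All []         = []
  selections-All (px ∷ pxs) = (px , pxs) ∷ map⁺ (All.map (λ (py , pr) → py , px ∷ pr) (selections-All pxs))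

  selections-increasing : ∀ {xs} → Increasing xs → All (λ p → Increasing (proj₂ p)) (selections xs)
  selections-increasing []          = []
  selections-increasing (x< ∷ xs↗) =
    xs↗ ∷ map⁺ (All.zipWith (λ (r↗ , _ , x<r) → x<r ∷ r↗) (selections-increasing xs↗ , selections-All x<))

  ∑-selections-rank : ∀ (g : ℕ → ℤ) xs → Increasing xs →
    ∑ (λ p → g (countBelow (proj₁ p) (proj₂ p))) (selections xs) ≡ ∑ g (upTo (length xs))
  ∑-selections-rank g []       []          = refl
  ∑-selections-rank g (x ∷ xs) (x< ∷ xs↗) = cong₂ _+_ (cong g (countBelow-least x<)) (begin
    ∑ (λ p → g (countBelow (proj₁ p) (proj₂ p))) (map (map₂ (x ∷_)) (selections xs))
      ≡⟨ ∑-map _ (map₂ (x ∷_)) (selections xs) ⟩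
    ∑ (λ p → g (countBelow (proj₁ p) (x ∷ proj₂ p))) (selections xs)
      ≡⟨ ∑-cong (All.map (λ {p} (x<y , _) → cong g (countBelow-above {proj₁ p} {proj₂ p} x<y))
                         (selections-All x<)) ⟩
    ∑ (λ p → g (suc (countBelow (proj₁ p) (proj₂ p)))) (selections xs)
      ≡⟨ ∑-selections-rank (λ c → g (suc c)) xs xs↗ ⟩
    ∑ (λ c → g (suc c)) (upTo (length xs))
      ≡⟨ sym (trans (cong (∑ g) (sym (map-upTo suc (length xs)))) (∑-map g suc (upTo (length xs)))) ⟩
    ∑ g (applyUpTo suc (length xs)) ∎)
    where
    countBelow-above : ∀ {y r} → x < y → countBelow y (x ∷ r) ≡ suc (countBelow y r)
    countBelow-above x<y rewrite <ᵇ-true x<y = refl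

  ∑-permutations-rank : ∀ (g : ℕ → ℤ) (h h′ : List ℕ → ℤ) v x xs → Increasing (x ∷ xs) →
    (∀ y ρ → h (y ∷ ρ) ≡ g (countBelow y ρ) * h′ ρ) →
    (∀ r → Increasing r → length r ≡ length xs → ∑ h′ (permutations r) ≡ v) →
    ∑ h (permutations (x ∷ xs)) ≡ ∑ g (upTo (suc (length xs))) * v
  ∑-permutations-rank g h h′ v x xs xs↗ factor sum′ = begin
    ∑ h (permutations (x ∷ xs))                 ≡⟨ ∑-permutations x xs h ⟩
    ∑ (byFirst h) (selections (x ∷ xs))
      ≡⟨ ∑-cong (All.zipWith byFirst≡ (selections-increasing xs↗ , selections-remainder-length (x ∷ xs))) ⟩
    ∑ (λ p → g (rank p) * v) (selections (x ∷ xs)) ≡⟨ ∑-*ʳ (λ p → g (rank p)) v (selections (x ∷ xs)) ⟩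
    ∑ (λ p → g (rank p)) (selections (x ∷ xs)) * v ≡⟨ cong (_* v) (∑-selections-rank g (x ∷ xs) xs↗) ⟩
    ∑ g (upTo (suc (length xs))) * v             ∎
    where
    rank : ℕ × List ℕ → ℕ
    rank (y , r) = countBelow y r
    byFirst≡ : ∀ {p} → Increasing (proj₂ p) × suc (length (proj₂ p)) ≡ length (x ∷ xs) →
               byFirst h p ≡ g (rank p) * v
    byFirst≡ {y , r} (r↗ , len) = begin
      ∑ (λ ρ → h (y ∷ ρ)) (permutations r)          ≡⟨ ∑-cong (All.universal (factor y) (permutations r)) ⟩
      ∑ (λ ρ → g (countBelow y ρ) * h′ ρ) (permutations r)
        ≡⟨ ∑-cong (All.map (λ ρ↭r → cong (λ c → g c * h′ _) (countBelow-↭ y ρ↭r)) (permutations-↭ r)) ⟩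
      ∑ (λ ρ → g (countBelow y r) * h′ ρ) (permutations r) ≡⟨ ∑-*ˡ (g (countBelow y r)) h′ (permutations r) ⟩
      g (countBelow y r) * ∑ h′ (permutations r)
        ≡⟨ cong (_*_ (g (countBelow y r))) (sum′ r r↗ (ℕ.suc-injective len)) ⟩
      g (countBelow y r) * v                         ∎

  ∑-permutations-const : ∀ n xs → length xs ≡ n → ∑ (λ _ → 1ℤ) (permutations xs) ≡ + (n !)
  ∑-permutations-const zero    []       refl = refl
  ∑-permutations-const (suc n) (x ∷ xs) len = begin
    ∑ (λ _ → 1ℤ) (permutations (x ∷ xs))     ≡⟨ ∑-permutations x xs (λ _ → 1ℤ) ⟩
    ∑ (byFirst (λ _ → 1ℤ)) (selections (x ∷ xs))
      ≡⟨ ∑-const (+ (n !)) (All.map (λ {p} len′ → ∑-permutations-const n (proj₂ p)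
                                                     (ℕ.suc-injective (trans len′ len)))
                                     (selections-remainder-length (x ∷ xs))) ⟩
    + length (selections (x ∷ xs)) * + (n !)
      ≡⟨ cong (λ l → + l * + (n !)) (trans (length-selections (x ∷ xs)) len) ⟩
    + suc n * + (n !)                        ≡⟨ sym (ℤ.pos-* (suc n) (n !)) ⟩
    + (suc n !)                              ∎

  sign : Bool → ℤ
  sign true  = 1ℤ
  sign false = -1ℤ

  sign-xor : ∀ a b → sign (a xor b) ≡ sign (not a) * sign b
  sign-xor true  true  = refl
  sign-xor true  false = refl
  sign-xor false true  = refl
  sign-xor false false = refl

  signedFalling : ℕ → ℕ → ℤ
  signedFalling n zero    = 1ℤ
  signedFalling n (suc k) = (+ suc k - + n) * signedFalling n k

  ∑-sign-threshold : ∀ k n → ∑ (λ c → sign (not (k <ᵇ c))) (upTo (suc k ℕ.+ n)) ≡ + suc k - + n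
  ∑-sign-threshold k n = begin
    ∑ f (upTo (suc k ℕ.+ n))                                   ≡⟨ cong (∑ f) (applyUpTo-++ id (suc k) n) ⟩
    ∑ f (upTo (suc k) ++ applyUpTo (suc k ℕ.+_) n)              ≡⟨ ∑-++ f (upTo (suc k)) _ ⟩
    ∑ f (upTo (suc k)) + ∑ f (applyUpTo (suc k ℕ.+_) n)
      ≡⟨ cong₂ _+_
           (∑-const 1ℤ (applyUpTo⁺₁ id (suc k) (λ i<1+k → cong (sign ∘ not) (<ᵇ-false (ℕ.s≤s⁻¹ i<1+k)))))
           (∑-const -1ℤ (applyUpTo⁺₂ (suc k ℕ.+_) n (λ i → cong (sign ∘ not) (<ᵇ-true (ℕ.m≤m+n (suc k) i))))) ⟩
    + length (upTo (suc k)) * 1ℤ + + length (applyUpTo (suc k ℕ.+_) n) * -1ℤ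
      ≡⟨ cong₂ (λ a b → + a * 1ℤ + + b * -1ℤ) (length-applyUpTo id (suc k)) (length-applyUpTo (suc k ℕ.+_) n) ⟩
    + suc k * 1ℤ + + n * -1ℤ                                    ≡⟨ difference (+ suc k) (+ n) ⟩
    + suc k - + n                                               ∎
    where
    f : ℕ → ℤ
    f c = sign (not (k <ᵇ c))
    difference : ∀ a b → a * 1ℤ + b * -1ℤ ≡ a - b
    difference = solve-∀

  ∑-sign-ordered : ∀ n k xs → Increasing xs → length xs ≡ k ℕ.+ n →
    ∑ (λ π → sign (ordered k π)) (permutations xs) ≡ + (n !) * signedFalling n k
  ∑-sign-ordered n zero    xs       _   len = trans (∑-permutations-const n xs len) (sym (ℤ.*-identityʳ (+ (n !))))
  ∑-sign-ordered n (suc k) (x ∷ xs) xs↗ len = begin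
    ∑ (λ π → sign (ordered (suc k) π)) (permutations (x ∷ xs))
      ≡⟨ ∑-permutations-rank g (λ π → sign (ordered (suc k) π)) (λ π → sign (ordered k π)) v x xs xs↗
           (λ y ρ → sign-xor (k <ᵇ countBelow y ρ) (ordered k ρ))
           (λ r r↗ |r| → ∑-sign-ordered n k r r↗ (trans |r| (ℕ.suc-injective len))) ⟩
    ∑ g (upTo (suc (length xs))) * v          ≡⟨ cong (λ l → ∑ g (upTo l) * v) len ⟩
    ∑ g (upTo (suc k ℕ.+ n)) * v              ≡⟨ cong (_* v) (∑-sign-threshold k n) ⟩
    (+ suc k - + n) * (+ (n !) * signedFalling n k) ≡⟨ swap-factor (+ suc k - + n) (+ (n !)) (signedFalling n k) ⟩
    + (n !) * signedFalling n (suc k)         ∎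
    where
    g : ℕ → ℤ
    g c = sign (not (k <ᵇ c))
    v : ℤ
    v = + (n !) * signedFalling n k
    swap-factor : ∀ a b c → a * (b * c) ≡ b * (a * c)
    swap-factor = solve-∀

  C*!≡P′ : ∀ {K k} → k ≤ K → (K C k) ℕ.* k ! ≡ K P′ k
  C*!≡P′ {K} {k} k≤K = begin
    (K C k) ℕ.* k !                       ≡⟨ cong (ℕ._* k !) (nCk≡nPk/k! k≤K) ⟩
    ((K P k) ℕ./ k !) ℕ.* k !             ≡⟨ cong (λ p → (p ℕ./ k !) ℕ.* k !) P≡P′ ⟩
    ((K P′ k) ℕ./ k !) ℕ.* k !            ≡⟨ m/n*n≡m (k!∣nP′k k≤K) ⟩
    K P′ k                              ∎
    where
    instance
      k!≢0 : ℕ.NonZero (k !)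
      k!≢0 = k ℕ.!≢0
    P≡P′ : K P k ≡ K P′ k
    P≡P′ rewrite Equivalence.to T-≡ (ℕ.≤⇒≤ᵇ k≤K) = refl

  C*!-vanishes : ∀ {K k} → K < k → (K C k) ℕ.* k ! ≡ 0
  C*!-vanishes K<k = cong (ℕ._* _) (k>n⇒nCk≡0 K<k)

  C*!-suc : ∀ K k → (K C suc k) ℕ.* suc k ! ≡ (K ∸ k) ℕ.* ((K C k) ℕ.* k !)
  C*!-suc K k with k ℕ.<? K
  ... | yes k<K = trans (C*!≡P′ k<K) (cong ((K ∸ k) ℕ.*_) (sym (C*!≡P′ (ℕ.<⇒≤ k<K))))
  ... | no  k≮K = trans (C*!-vanishes (s≤s (ℕ.≮⇒≥ k≮K)))
                        (sym (cong (ℕ._* ((K C k) ℕ.* k !)) (ℕ.m≤n⇒m∸n≡0 (ℕ.≮⇒≥ k≮K))))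

  falling-step : ∀ K k → (+ k - + K) * + ((K C k) ℕ.* k !) ≡ - + ((K C suc k) ℕ.* suc k !)
  falling-step K k with k ℕ.≤? K
  ... | yes k≤K = begin
    (+ k - + K) * + G                ≡⟨ cong (_* + G) (trans (ℤ.m-n≡m⊖n k K) (ℤ.⊖-≤ k≤K)) ⟩
    - + (K ∸ k) * + G                ≡⟨ sym (ℤ.neg-distribˡ-* (+ (K ∸ k)) (+ G)) ⟩
    - (+ (K ∸ k) * + G)              ≡⟨ cong -_ (sym (ℤ.pos-* (K ∸ k) G)) ⟩
    - + ((K ∸ k) ℕ.* G)              ≡⟨ cong (λ g → - + g) (sym (C*!-suc K k)) ⟩
    - + ((K C suc k) ℕ.* suc k !)      ∎
    where
    G : ℕ
    G = (K C k) ℕ.* k !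
  ... | no  k≰K = begin
    (+ k - + K) * + ((K C k) ℕ.* k !)  ≡⟨ cong (λ g → (+ k - + K) * + g) (C*!-vanishes (ℕ.≰⇒> k≰K)) ⟩
    (+ k - + K) * 0ℤ                 ≡⟨ ℤ.*-zeroʳ (+ k - + K) ⟩
    0ℤ                               ≡⟨ cong (λ g → - + g) (sym (C*!-vanishes (ℕ.m<n⇒m<1+n (ℕ.≰⇒> k≰K)))) ⟩
    - + ((K C suc k) ℕ.* suc k !)      ∎

  signedFalling-C : ∀ K k → signedFalling (suc K) k ≡ (-1ℤ ^ k) * + ((K C k) ℕ.* k !)
  signedFalling-C K zero    = refl
  signedFalling-C K (suc k) = begin
    (+ suc k - + suc K) * signedFalling (suc K) k           ≡⟨ cong (_*_ (+ suc k - + suc K)) (signedFalling-C K k) ⟩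
    (+ suc k - + suc K) * ((-1ℤ ^ k) * + G)                 ≡⟨ shift (+ k) (+ K) (-1ℤ ^ k) (+ G) ⟩
    (-1ℤ ^ k) * ((+ k - + K) * + G)                         ≡⟨ cong (_*_ (-1ℤ ^ k)) (falling-step K k) ⟩
    (-1ℤ ^ k) * - + ((K C suc k) ℕ.* suc k !)                 ≡⟨ negate (-1ℤ ^ k) (+ ((K C suc k) ℕ.* suc k !)) ⟩
    (-1ℤ ^ suc k) * + ((K C suc k) ℕ.* suc k !)               ∎
    where
    G : ℕ
    G = (K C k) ℕ.* k !
    shift : ∀ a b s g → ((1ℤ + a) - (1ℤ + b)) * (s * g) ≡ s * ((a - b) * g)
    shift = solve-∀
    negate : ∀ s g → s * - g ≡ -1ℤ * s * g
    negate = solve-∀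

  signedFalling≡0⇔ : ∀ {n} k → 1 ≤ n → (signedFalling n k ≡ 0ℤ ⇔ n ≤ k)
  signedFalling≡0⇔ {n} k 1≤n = mk⇔ (vanishes⇒ k) (⇒vanishes k)
    where
    vanishes⇒ : ∀ k → signedFalling n k ≡ 0ℤ → n ≤ k
    vanishes⇒ (suc k) eq with ℤ.i*j≡0⇒i≡0∨j≡0 (+ suc k - + n) eq
    ... | inj₁ factor≡0 = ℕ.≤-reflexive (sym (ℤ.+-injective (ℤ.i-j≡0⇒i≡j (+ suc k) (+ n) factor≡0)))
    ... | inj₂ rest≡0   = ℕ.m≤n⇒m≤1+n (vanishes⇒ k rest≡0)
    ⇒vanishes : ∀ k → n ≤ k → signedFalling n k ≡ 0ℤ
    ⇒vanishes zero    n≤0 = contradiction (ℕ.≤-trans 1≤n n≤0) λ ()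
    ⇒vanishes (suc k) n≤1+k with ℕ.m≤n⇒m<n∨m≡n n≤1+k
    ... | inj₁ n<1+k  = trans (cong (_*_ (+ suc k - + n)) (⇒vanishes k (s≤s⁻¹ n<1+k))) (ℤ.*-zeroʳ (+ suc k - + n))
    ... | inj₂ n≡1+k = trans (cong (_* signedFalling n k) (ℤ.i≡j⇒i-j≡0 (cong +_ (sym n≡1+k))))
                             (ℤ.*-zeroˡ (signedFalling n k))

  filter-difference : ∀ (out : List ℕ → List ℕ) (b : List ℕ → Bool) {T T′ : List ℕ} → T ≢ T′ → ∀ L →
    All (λ π → out π ≡ (if b π then T else T′)) L →
    + length (filter (λ π → ≡-dec _≟_ (out π) T) L) - + length (filter (λ π → ≡-dec _≟_ (out π) T′) L)
      ≡ ∑ (λ π → sign (b π)) L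
  filter-difference out b T≢T′ []      []         = refl
  filter-difference out b {T} {T′} T≢T′ (π ∷ L) (eq ∷ eqs) with b π
  ... | true
    rewrite filter-accept (λ π → ≡-dec _≟_ (out π) T) {π} {L} eq
          | filter-reject (λ π → ≡-dec _≟_ (out π) T′) {π} {L} (λ eq′ → T≢T′ (trans (sym eq) eq′))
    = trans (one-more (+ length (filter _ L)) (+ length (filter _ L)))
            (cong (_+_ 1ℤ) (filter-difference out b T≢T′ L eqs))
    where
    one-more : ∀ a b → (1ℤ + a) - b ≡ 1ℤ + (a - b)
    one-more = solve-∀
  ... | false
    rewrite filter-reject (λ π → ≡-dec _≟_ (out π) T) {π} {L} (λ eq′ → T≢T′ (trans (sym eq′) eq))
          | filter-accept (λ π → ≡-dec _≟_ (out π) T′) {π} {L} eq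
    = trans (one-less (+ length (filter _ L)) (+ length (filter _ L)))
            (cong (_+_ -1ℤ) (filter-difference out b T≢T′ L eqs))
    where
    one-less : ∀ a b → a - (1ℤ + b) ≡ -1ℤ + (a - b)
    one-less = solve-∀

open JeuDeTaquin using (ordered; jdtD-permutation; permutations-↭; upTo-increasing; T₁≢T₂)
open SignedCount using (∑; sign; signedFalling; signedFalling-C; signedFalling≡0⇔; ∑-sign-ordered; filter-difference)

open import Data.Nat using (ℕ; suc; _+_; _≤_; _∸_; _!; z≤n; s≤s) renaming (_*_ to _*ℕ_)
open import Data.Nat.Properties using (_!≢0)
open import Data.Nat.Combinatorics using (_C_)
open import Data.Integer using (ℤ; +_; _-_; _*_; _^_; 0ℤ; -1ℤ)
import Data.Integer.Properties as ℤ
open import Data.Integer.Tactic.RingSolver using (solve-∀)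
open import Data.List using (applyUpTo)
open import Data.List.Properties using (length-applyUpTo)
open import Data.List.Relation.Unary.All as All using ()
open import Data.Product using (_×_; _,_)
open import Function.Bundles using (_⇔_; mk⇔; Equivalence)
open import Relation.Binary.PropositionalEquality using (_≡_; sym; trans; cong; module ≡-Reasoning)
open ≡-Reasoning

signed-difference : ∀ m n → 2 ≤ m → 2 ≤ n → + s₁ m n - + s₂ m n ≡ + (n !) * signedFalling n m
signed-difference m n 2≤m 2≤n = begin
  + s₁ m n - + s₂ m n
    ≡⟨ filter-difference (jdtD m n) (ordered m) (T₁≢T₂ m n) (S (m + n))
         (All.map (jdtD-permutation m n 2≤m 2≤n _) (permutations-↭ (applyUpTo suc (m + n)))) ⟩
  ∑ (λ π → sign (ordered m π)) (S (m + n))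
    ≡⟨ ∑-sign-ordered n m (applyUpTo suc (m + n)) (upTo-increasing (m + n)) (length-applyUpTo suc (m + n)) ⟩
  + (n !) * signedFalling n m ∎

theorem1p1 : (m n : ℕ) → 2 ≤ m → 2 ≤ n →
    ((+ s₁ m n) - (+ s₂ m n) ≡ (-1ℤ ^ m) * (+ ((((n ∸ 1) C m) *ℕ (m !)) *ℕ (n !))))
    × (s₁ m n ≡ s₂ m n ⇔ n ≤ m)
theorem1p1 m n@(suc K) 2≤m 2≤n = difference , mk⇔ equal⇒n≤m n≤m⇒equal
  where
  difference : + s₁ m n - + s₂ m n ≡ (-1ℤ ^ m) * + (((K C m) *ℕ m !) *ℕ n !)
  difference = begin
    + s₁ m n - + s₂ m n                          ≡⟨ signed-difference m n 2≤m 2≤n ⟩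
    + (n !) * signedFalling n m                  ≡⟨ cong (_*_ (+ (n !))) (signedFalling-C K m) ⟩
    + (n !) * ((-1ℤ ^ m) * + ((K C m) *ℕ m !))   ≡⟨ swap-factor (+ (n !)) (-1ℤ ^ m) (+ ((K C m) *ℕ m !)) ⟩
    (-1ℤ ^ m) * (+ ((K C m) *ℕ m !) * + (n !))  ≡⟨ cong (_*_ (-1ℤ ^ m)) (sym (ℤ.pos-* ((K C m) *ℕ m !) (n !))) ⟩
    (-1ℤ ^ m) * + (((K C m) *ℕ m !) *ℕ n !)      ∎
    where
    swap-factor : ∀ a s g → a * (s * g) ≡ s * (g * a)
    swap-factor = solve-∀
  equal⇒n≤m : s₁ m n ≡ s₂ m n → n ≤ m
  equal⇒n≤m eq = Equivalence.to (signedFalling≡0⇔ m (s≤s z≤n))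
    (ℤ.*-cancelˡ-≡ (+ (n !)) (signedFalling n m) 0ℤ {{n !≢0}}
      (trans (sym (signed-difference m n 2≤m 2≤n))
             (trans (ℤ.i≡j⇒i-j≡0 (cong +_ eq)) (sym (ℤ.*-zeroʳ (+ (n !)))))))
  n≤m⇒equal : n ≤ m → s₁ m n ≡ s₂ m n
  n≤m⇒equal n≤m = ℤ.+-injective (ℤ.i-j≡0⇒i≡j (+ s₁ m n) (+ s₂ m n)
    (trans (signed-difference m n 2≤m 2≤n)
      (trans (cong (_*_ (+ (n !))) (Equivalence.from (signedFalling≡0⇔ m (s≤s z≤n)) n≤m))
             (ℤ.*-zeroʳ (+ (n !))))))
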